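{- Let $\sigma\in K_n$. Suppose that $\sigma_i$ separates $\sigma_j$ from some element of $\sigma$ and that $\sigma_j$ separates $\sigma_i$ from some element of $\sigma$. Then $\sigma_i$ and $\sigma_j$ are separators of the same type (both vertical or both horizontal).
   Context: Permutations are written in one-line notation $\sigma=[\sigma_1,\dots,\sigma_n]$. $K_n$ is the set of $\sigma\in S_n$ with $|\sigma_i-\sigma_{i-1}|\neq1$ for all $2\le i\le n$ (king permutations). A $2$-block is a pair of adjacent positions whose values are consecutive integers. For $\sigma\in S_n$, the entry $\sigma_i=a$ separates $\sigma_{j_1}$ from $\sigma_{j_2}$ if deleting $a$ (and standardizing) produces a new $2$-block, which happens exactly when either (vertical separator) $j_1,i,j_2$ are consecutive positions and $|\sigma_{j_1}-\sigma_{j_2}|=1$, i.e. $\sigma=[\dots,b,a,b\pm1,\dots]$; or (horizontal separator) $\sigma_{j_1},a,\sigma_{j_2}$ are consecutive integers and $|j_1-j_2|=1$, i.e. $\sigma=[\dots,a,\dots,a\pm1,a\mp1,\dots]$ or $\sigma=[\dots,a\pm1,a\mp1,\dots,a,\dots]$. -}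

module Defs where

open import Data.Nat using (ℕ; suc)
open import Data.Fin using (Fin; toℕ)
open import Data.Fin.Permutation using (Permutation′; _⟨$⟩ʳ_)
open import Data.Product using (_×_)
open import Data.Sum using (_⊎_)
open import Relation.Nullary using (¬_)
open import Relation.Binary.PropositionalEquality using (_≡_)

-- Positions are Fin n (0-based), values are σ ⟨$⟩ʳ i read in ℕ via toℕ
-- (0-based values; consecutiveness is shift-invariant).

val : ∀ {n} → Permutation′ n → Fin n → ℕ
val σ i = toℕ (σ ⟨$⟩ʳ i)

Consec : ℕ → ℕ → Set
Consec a b = suc a ≡ b ⊎ suc b ≡ a

Next : ∀ {n} → Fin n → Fin n → Set
Next p q = suc (toℕ p) ≡ toℕ q

King : ∀ {n} → Permutation′ n → Set
King {n} σ = ∀ (p q : Fin n) → Next p q → ¬ Consec (val σ p) (val σ q)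

VSep : ∀ {n} → Permutation′ n → Fin n → Fin n → Fin n → Set
VSep σ i j k = ((Next j i × Next i k) ⊎ (Next k i × Next i j))
             × Consec (val σ j) (val σ k)

HSep : ∀ {n} → Permutation′ n → Fin n → Fin n → Fin n → Set
HSep σ i j k = ((suc (val σ j) ≡ val σ i × suc (val σ i) ≡ val σ k)
                ⊎ (suc (val σ k) ≡ val σ i × suc (val σ i) ≡ val σ j))
             × (Next j k ⊎ Next k j)

Separates : ∀ {n} → Permutation′ n → Fin n → Fin n → Fin n → Set
Separates σ i j k = VSep σ i j k ⊎ HSep σ i j k

-- A vertical separator sits next to each entry it separates, while a
-- horizontal separator has a value consecutive to each entry it separates.
-- So if σ_i and σ_j separated each other with different types, they would
-- be adjacent entries with consecutive values, which a king permutation forbids.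
module Submission where

open import Defs
open import Data.Fin using (Fin)
open import Data.Fin.Permutation using (Permutation′)
open import Data.Product using (_×_; _,_)
open import Data.Sum using (_⊎_; inj₁; inj₂; swap)
open import Data.Empty using (⊥-elim)
open import Relation.Nullary using (¬_)

Adjacent : ∀ {n} → Fin n → Fin n → Set
Adjacent p q = Next p q ⊎ Next q p

Consec-sym : ∀ {a b} → Consec a b → Consec b a
Consec-sym = swap

King⇒¬Consec-adjacent : ∀ {n} (σ : Permutation′ n) → King σ →
  ∀ p q → Adjacent p q → ¬ Consec (val σ p) (val σ q)
King⇒¬Consec-adjacent _ K p q (inj₁ p→q) c = K p q p→q c
King⇒¬Consec-adjacent _ K p q (inj₂ q→p) c = K q p q→p (Consec-sym c)

VSep⇒adjacent : ∀ {n} (σ : Permutation′ n) i j k → VSep σ i j k → Adjacent i j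
VSep⇒adjacent _ _ _ _ (inj₁ (j→i , _) , _) = inj₂ j→i
VSep⇒adjacent _ _ _ _ (inj₂ (_ , i→j) , _) = inj₁ i→j

HSep⇒Consec : ∀ {n} (σ : Permutation′ n) i j k → HSep σ i j k →
  Consec (val σ i) (val σ j)
HSep⇒Consec _ _ _ _ (inj₁ (j+1≡i , _) , _) = inj₂ j+1≡i
HSep⇒Consec _ _ _ _ (inj₂ (_ , i+1≡j) , _) = inj₁ i+1≡j

King⇒¬VSep×HSep : ∀ {n} (σ : Permutation′ n) → King σ →
  ∀ i j k l → VSep σ i j k → ¬ HSep σ j i l
King⇒¬VSep×HSep σ K i j k l v h =
  King⇒¬Consec-adjacent σ K i j (VSep⇒adjacent σ i j k v)
    (Consec-sym (HSep⇒Consec σ j i l h))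

mainTheorem3 : ∀ {n} (σ : Permutation′ n) → King σ →
    ∀ (i j k l : Fin n) → Separates σ i j k → Separates σ j i l →
    (VSep σ i j k × VSep σ j i l) ⊎ (HSep σ i j k × HSep σ j i l)
mainTheorem3 σ K i j k l (inj₁ v) (inj₁ v′) = inj₁ (v , v′)
mainTheorem3 σ K i j k l (inj₂ h) (inj₂ h′) = inj₂ (h , h′)
mainTheorem3 σ K i j k l (inj₁ v) (inj₂ h′) = ⊥-elim (King⇒¬VSep×HSep σ K i j k l v h′)
mainTheorem3 σ K i j k l (inj₂ h) (inj₁ v′) = ⊥-elim (King⇒¬VSep×HSep σ K j i l k v′ h)
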